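{- Let $A$ be a definably connected abelian group, definable in some structure, satisfying the descending chain condition on definable subgroups and containing no infinite elementary abelian $p$-subgroup for any prime $p$. Then $A$ is divisible.
   Context: Definability refers to a fixed first-order structure $\mathcal M$ (possibly in $\mathcal M^{eq}$). The descending chain condition on definable subgroups means every strictly descending chain of definable subgroups is finite. A definable group is definably connected if it has no proper definable subgroup of finite index. -}

module Defs where

open import Level using (0ℓ)
open import Data.Nat using (ℕ; zero; suc; _+_)
open import Data.Fin using (Fin)
open import Data.Vec using (Vec; []; _∷_; lookup; _++_)
open import Data.List using (List)
open import Data.Product using (Σ; ∃; _×_; _,_)
open import Data.Sum using (_⊎_)
open import Data.Empty using (⊥)
open import Relation.Nullary using (¬_)
open import Algebra.Bundles using (AbelianGroup)
open import Data.List.Relation.Unary.Any using (Any)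

record Language : Set₁ where
  field
    Func : ℕ → Set    -- function symbols of each arity (constants: arity 0)
    Rel  : ℕ → Set

module FOL (L : Language) where
  open Language L

  -- terms with n free variables (de Bruijn indices)
  data Term (n : ℕ) : Set where
    var  : Fin n → Term n
    func : ∀ {k} → Func k → Vec (Term n) k → Term n

  data Formula (n : ℕ) : Set where
    ⊥f   : Formula n
    _≐_  : Term n → Term n → Formula n
    rel  : ∀ {k} → Rel k → Vec (Term n) k → Formula n
    _∧f_ : Formula n → Formula n → Formula n
    _∨f_ : Formula n → Formula n → Formula n
    _⇒f_ : Formula n → Formula n → Formula n
    ∀f   : Formula (suc n) → Formula n
    ∃f   : Formula (suc n) → Formula n

  record Structure (M : Set) (_≈_ : M → M → Set) : Set₁ where
    field
      funᴹ : ∀ {k} → Func k → Vec M k → M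
      relᴹ : ∀ {k} → Rel k → Vec M k → Set

    mutual
      ⟦_⟧t : ∀ {n} → Term n → Vec M n → M
      ⟦ var i ⟧t ρ = lookup ρ i
      ⟦ func f ts ⟧t ρ = funᴹ f (⟦ ts ⟧ts ρ)

      ⟦_⟧ts : ∀ {n k} → Vec (Term n) k → Vec M n → Vec M k
      ⟦ [] ⟧ts ρ = []
      ⟦ t ∷ ts ⟧ts ρ = ⟦ t ⟧t ρ ∷ ⟦ ts ⟧ts ρ

    Sat : ∀ {n} → Formula n → Vec M n → Set
    Sat ⊥f ρ = ⊥
    Sat (s ≐ t) ρ = ⟦ s ⟧t ρ ≈ ⟦ t ⟧t ρ
    Sat (rel r ts) ρ = relᴹ r (⟦ ts ⟧ts ρ)
    Sat (φ ∧f ψ) ρ = Sat φ ρ × Sat ψ ρ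
    Sat (φ ∨f ψ) ρ = Sat φ ρ ⊎ Sat ψ ρ
    Sat (φ ⇒f ψ) ρ = Sat φ ρ → Sat ψ ρ
    Sat (∀f φ) ρ = (x : M) → Sat φ (x ∷ ρ)
    Sat (∃f φ) ρ = Σ M (λ x → Sat φ (x ∷ ρ))

    Definable : ∀ {k} → (Vec M k → Set) → Set
    Definable {k} R =
      Σ ℕ λ m → Σ (Formula (k + m)) λ φ → Σ (Vec M m) λ params →
        (xs : Vec M k) → (R xs → Sat φ (xs ++ params)) × (Sat φ (xs ++ params) → R xs)

module GroupNotions (A : AbelianGroup 0ℓ 0ℓ) where
  open AbelianGroup A

  _·_ : ℕ → Carrier → Carrier
  zero · x = ε
  suc n · x = x ∙ (n · x)

  record IsSubgroup (H : Carrier → Set) : Set where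
    field
      resp  : ∀ {x y} → x ≈ y → H x → H y
      ε∈    : H ε
      ∙-closed : ∀ {x y} → H x → H y → H (x ∙ y)
      ⁻¹-closed : ∀ {x} → H x → H (x ⁻¹)

  Proper : (Carrier → Set) → Set
  Proper H = Σ Carrier λ x → ¬ H x

  -- finitely many cosets g H cover A
  FiniteIndex : (Carrier → Set) → Set
  FiniteIndex H = Σ (List Carrier) λ gs → (x : Carrier) → Any (λ g → H ((g ⁻¹) ∙ x)) gs

  FiniteSet : (Carrier → Set) → Set
  FiniteSet H = Σ (List Carrier) λ xs → (x : Carrier) → H x → Any (λ y → x ≈ y) xs

  Infinite : (Carrier → Set) → Set
  Infinite H = ¬ FiniteSet H

  _⊆_ : (Carrier → Set) → (Carrier → Set) → Set
  H ⊆ K = ∀ x → H x → K x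

  _⊊_ : (Carrier → Set) → (Carrier → Set) → Set
  H ⊊ K = (H ⊆ K) × Σ Carrier (λ x → K x × ¬ H x)

  IsElementaryAbelianPSubgroup : ℕ → (Carrier → Set) → Set
  IsElementaryAbelianPSubgroup p H = IsSubgroup H × (∀ x → H x → (p · x) ≈ ε)

  Divisible : Set
  Divisible = (n : ℕ) (a : Carrier) → Σ Carrier λ b → (suc n · b) ≈ a

module DefinableGroup (A : AbelianGroup 0ℓ 0ℓ) (L : Language) where
  open AbelianGroup A
  open GroupNotions A public
  open FOL L public

  module _ (M : Structure Carrier _≈_) where
    open Structure M

    -- the graph of the group operation is definable, so A is a definable group
    GroupDefinable : Set
    GroupDefinable = Definable {3} (λ where (x ∷ y ∷ z ∷ []) → (x ∙ y) ≈ z)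

    DefinableSet : (Carrier → Set) → Set
    DefinableSet H = Definable {1} (λ where (x ∷ []) → H x)

    IsDefinableSubgroup : (Carrier → Set) → Set
    IsDefinableSubgroup H = IsSubgroup H × DefinableSet H

    DCC : Set₁
    DCC = ¬ (Σ (ℕ → Carrier → Set) λ H →
               ((n : ℕ) → IsDefinableSubgroup (H n)) × ((n : ℕ) → H (suc n) ⊊ H n))

    DefinablyConnected : Set₁
    DefinablyConnected = (H : Carrier → Set) → IsDefinableSubgroup H →
                         FiniteIndex H → ¬ Proper H

-- For a prime p the p-torsion A[p] is elementary abelian, hence finite, and then so is
-- every A[pᵏ]. The images pᵏA form a descending chain of definable subgroups, which by DCC
-- stabilises at some B = pⁿA; thus B ⊆ pB and hence B ⊆ pⁿB. Every x then has pⁿx = pⁿb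
-- with b ∈ B, so x lies in the coset (x - b) + B with x - b ∈ A[pⁿ]: B has finite index,
-- and definable connectedness forces B = A, i.e. A = pA. Prime factorisation gives
-- divisibility by every n. Excluded middle turns the negative hypotheses (finiteness,
-- DCC, connectedness) into the witnesses the argument needs.
module Submission where

open import Defs
open import Level using (0ℓ)
open import Data.Nat using (ℕ; zero; suc; _+_; _*_; _^_)
open import Data.Nat.Primality using (Prime)
open import Data.Nat.Properties using (*-comm)
open import Data.Nat.Divisibility using (_∣_; divides; n∣m*n)
open import Data.Nat.ListAction using (product)
open import Data.Nat.Primality.Factorisation using (factorise)
open import Data.Fin using (Fin; zero; suc; lift; _↑ˡ_; _↑ʳ_)
open import Data.Vec using (Vec; []; _∷_; lookup; _++_)
open import Data.Vec.Properties using (lookup-++ˡ; lookup-++ʳ)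
open import Data.List as List using (List; []; _∷_)
open import Data.List.Relation.Unary.Any as Any using (Any)
open import Data.List.Relation.Unary.Any.Properties using (map⁺; concat⁺)
open import Data.List.Relation.Unary.All as All using (All; []; _∷_)
open import Data.Product using (Σ; _×_; _,_; proj₁; proj₂; uncurry; map₂)
open import Data.Product.Function.NonDependent.Propositional using (_×-⇔_)
open import Data.Sum.Function.Propositional using (_⊎-⇔_)
open import Function using (_⇔_; mk⇔; Equivalence)
open import Function.Construct.Identity using (⇔-id)
open import Function.Construct.Composition using (_⇔-∘_)
open import Function.Related.TypeIsomorphisms using (→-cong-⇔)
open import Relation.Nullary using (¬_; yes; no)
open import Data.Empty using (⊥-elim)
open import Relation.Binary.PropositionalEquality as ≡ using (_≡_)
open import Algebra.Bundles using (AbelianGroup)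
open import Axiom.ExcludedMiddle using (ExcludedMiddle)
open import Axiom.DoubleNegationElimination using (em⇒dne)

open Equivalence using (to; from)

module Multiples (A : AbelianGroup 0ℓ 0ℓ) where
  open AbelianGroup A
  open GroupNotions A
  open import Algebra.Properties.AbelianGroup A
    using (inverseˡ-unique; ε⁻¹≈ε; x≈y⇒x∙y⁻¹≈ε; ⁻¹-anti-homo‿-; //-rightDividesˡ)
  open import Algebra.Properties.CommutativeMonoid.Mult commutativeMonoid
    using (×-congʳ; ×-congˡ; ×-assocˡ; ×-distrib-+)
    renaming (_×_ to _×ᴹ_)

  -- GroupNotions._·_ has the defining equations of the library's _×_, so its lemmas transfer.
  ·≡× : ∀ n x → n · x ≡ n ×ᴹ x
  ·≡× zero x = ≡.refl
  ·≡× (suc n) x = ≡.cong (x ∙_) (·≡× n x)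

  ·-congʳ : ∀ n {x y} → x ≈ y → (n · x) ≈ (n · y)
  ·-congʳ n {x} {y} e rewrite ·≡× n x | ·≡× n y = ×-congʳ n e

  ·-congˡ : ∀ {m n} x → m ≡ n → (m · x) ≈ (n · x)
  ·-congˡ {m} {n} x e rewrite ·≡× m x | ·≡× n x = ×-congˡ e

  ·-assoc : ∀ m n x → ((m * n) · x) ≈ (m · (n · x))
  ·-assoc m n x rewrite ·≡× (m * n) x | ·≡× n x | ·≡× m (n ×ᴹ x) = sym (×-assocˡ x m n)

  ·-distrib-∙ : ∀ n x y → (n · (x ∙ y)) ≈ ((n · x) ∙ (n · y))
  ·-distrib-∙ n x y rewrite ·≡× n (x ∙ y) | ·≡× n x | ·≡× n y = ×-distrib-+ x y n

  ·-ε : ∀ n → (n · ε) ≈ ε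
  ·-ε zero = refl
  ·-ε (suc n) = trans (identityˡ _) (·-ε n)

  ·-⁻¹ : ∀ n x → (n · (x ⁻¹)) ≈ ((n · x) ⁻¹)
  ·-⁻¹ n x = inverseˡ-unique _ _ (begin
    (n · (x ⁻¹)) ∙ (n · x)  ≈⟨ sym (·-distrib-∙ n (x ⁻¹) x) ⟩
    n · ((x ⁻¹) ∙ x)        ≈⟨ ·-congʳ n (inverseˡ x) ⟩
    n · ε                   ≈⟨ ·-ε n ⟩
    ε                       ∎)
    where open import Relation.Binary.Reasoning.Setoid setoid

  ker : ℕ → Carrier → Set
  ker n x = (n · x) ≈ ε

  img : ℕ → Carrier → Set
  img n x = Σ Carrier λ y → x ≈ (n · y)

  _·ˢ_ : ℕ → (Carrier → Set) → Carrier → Set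
  (n ·ˢ B) x = Σ Carrier λ b → B b × x ≈ (n · b)

  DivisibleBy : ℕ → Set
  DivisibleBy n = ∀ a → img n a

  ker-isSubgroup : ∀ n → IsSubgroup (ker n)
  ker-isSubgroup n = record
    { resp      = λ e kx → trans (·-congʳ n (sym e)) kx
    ; ε∈        = ·-ε n
    ; ∙-closed  = λ kx ky → trans (·-distrib-∙ n _ _) (trans (∙-cong kx ky) (identityˡ ε))
    ; ⁻¹-closed = λ kx → trans (·-⁻¹ n _) (trans (⁻¹-cong kx) ε⁻¹≈ε)
    }

  img-isSubgroup : ∀ n → IsSubgroup (img n)
  img-isSubgroup n = record
    { resp      = λ { e (y , x≈ny) → y , trans (sym e) x≈ny }
    ; ε∈        = ε , sym (·-ε n)
    ; ∙-closed  = λ { (y , x≈ny) (y′ , x′≈ny′) →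
                      y ∙ y′ , trans (∙-cong x≈ny x′≈ny′) (sym (·-distrib-∙ n y y′)) }
    ; ⁻¹-closed = λ { (y , x≈ny) → y ⁻¹ , trans (⁻¹-cong x≈ny) (sym (·-⁻¹ n y)) }
    }

  ker-difference : ∀ n {x y} → (n · x) ≈ (n · y) → ker n (x - y)
  ker-difference n {x} {y} e = trans (·-distrib-∙ n x (y ⁻¹))
    (trans (∙-congˡ (·-⁻¹ n y)) (x≈y⇒x∙y⁻¹≈ε e))

  img-antitone : ∀ {m n} → m ∣ n → img n ⊆ img m
  img-antitone {m} (divides q ≡.refl) x (y , x≈qmy) =
    q · y , trans x≈qmy (trans (·-congˡ y (*-comm q m)) (·-assoc m q y))

  ⊆-·ˢ-pow : ∀ {p B} → B ⊆ (p ·ˢ B) → ∀ k → B ⊆ ((p ^ k) ·ˢ B)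
  ⊆-·ˢ-pow B⊆pB zero x Bx = x , Bx , sym (identityʳ x)
  ⊆-·ˢ-pow {p} B⊆pB (suc k) x Bx with B⊆pB x Bx
  ... | b , Bb , x≈pb with ⊆-·ˢ-pow B⊆pB k b Bb
  ... | c , Bc , b≈pᵏc =
    c , Bc , trans x≈pb (trans (·-congʳ p b≈pᵏc) (sym (·-assoc p (p ^ k) c)))

  img-stable⇒⊆·ˢ : ∀ {p n} → img (p ^ n) ⊆ img (p ^ suc n) → img (p ^ n) ⊆ (p ·ˢ img (p ^ n))
  img-stable⇒⊆·ˢ {p} {n} stable x x∈img with stable x x∈img
  ... | y , x≈pⁿ⁺¹y = (p ^ n) · y , (y , refl) , trans x≈pⁿ⁺¹y (·-assoc p (p ^ n) y)

  finiteKernel⇒finiteIndex : ∀ {n B} → FiniteSet (ker n) → IsSubgroup B → img n ⊆ (n ·ˢ B) →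
                             FiniteIndex B
  finiteKernel⇒finiteIndex {n} {B} (ks , ks-cover) B-sub nA⊆nB = ks , coset
    where
      [x-b]⁻¹x≈b : ∀ {x b g} → (x - b) ≈ g → ((g ⁻¹) ∙ x) ≈ b
      [x-b]⁻¹x≈b {x} {b} {g} x-b≈g = begin
        (g ⁻¹) ∙ x        ≈⟨ ∙-congʳ (⁻¹-cong (sym x-b≈g)) ⟩
        ((x - b) ⁻¹) ∙ x  ≈⟨ ∙-congʳ (⁻¹-anti-homo‿- x b) ⟩
        (b - x) ∙ x       ≈⟨ //-rightDividesˡ x b ⟩
        b                 ∎
        where open import Relation.Binary.Reasoning.Setoid setoid

      coset : ∀ x → Any (λ g → B ((g ⁻¹) ∙ x)) ks
      coset x with nA⊆nB (n · x) (x , refl)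
      ... | b , b∈B , nx≈nb =
        Any.map (λ x-b≈g → IsSubgroup.resp B-sub (sym ([x-b]⁻¹x≈b x-b≈g)) b∈B)
                (ks-cover (x - b) (ker-difference n nx≈nb))

  divisibleBy-* : ∀ {m n} → DivisibleBy m → DivisibleBy n → DivisibleBy (m * n)
  divisibleBy-* {m} {n} m-div n-div a with m-div a
  ... | c , a≈mc with n-div c
  ... | d , c≈nd = d , trans a≈mc (trans (·-congʳ m c≈nd) (sym (·-assoc m n d)))

  divisibleBy-product : ∀ {ns} → All DivisibleBy ns → DivisibleBy (product ns)
  divisibleBy-product []                     a = a , sym (identityʳ a)
  divisibleBy-product {n ∷ ns} (n-div ∷ divs) =
    divisibleBy-* {n} {product ns} n-div (divisibleBy-product divs)

  divisibleByPrimes⇒divisible : (∀ p → Prime p → DivisibleBy p) → Divisible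
  divisibleByPrimes⇒divisible prime-div n a with factorise (suc n)
  ... | record { factors = ps ; isFactorisation = n≡∏ps ; factorsPrime = ps-prime }
    with divisibleBy-product (All.map (prime-div _) ps-prime) a
  ... | b , a≈∏ps·b = b , sym (trans a≈∏ps·b (·-congˡ b (≡.sym n≡∏ps)))

module Classical (em : ExcludedMiddle 0ℓ) (A : AbelianGroup 0ℓ 0ℓ) where
  open AbelianGroup A
  open GroupNotions A
  open Multiples A
  open import Algebra.Properties.AbelianGroup A using (//-rightDividesˡ)

  dne : ∀ {P : Set} → ¬ ¬ P → P
  dne = em⇒dne em

  finiteSet-⊆ : ∀ {H K} → K ⊆ H → FiniteSet H → FiniteSet K
  finiteSet-⊆ K⊆H (xs , xs-cover) = xs , λ x Kx → xs-cover x (K⊆H x Kx)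

  preimage-finite : ∀ n {Y} → FiniteSet (ker n) → FiniteSet Y → FiniteSet (λ x → Y (n · x))
  preimage-finite n {Y} (ks , ks-cover) (ys , ys-cover) =
    List.concatMap fibre ys ,
    λ x Ynx → concat⁺ (map⁺ (Any.map (fibre-complete x) (ys-cover (n · x) Ynx)))
    where
      fibre : Carrier → List Carrier
      fibre y with em {img n y}
      ... | yes (x₀ , _) = List.map (_∙ x₀) ks
      ... | no _         = []

      fibre-complete : ∀ x {y} → (n · x) ≈ y → Any (x ≈_) (fibre y)
      fibre-complete x {y} nx≈y with em {img n y}
      ... | yes (x₀ , y≈nx₀) =
        map⁺ (Any.map (λ x-x₀≈g → trans (sym (//-rightDividesˡ x₀ x)) (∙-congʳ x-x₀≈g))
                      (ks-cover (x - x₀) (ker-difference n (trans nx≈y y≈nx₀))))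
      ... | no ∉img = ⊥-elim (∉img (x , sym nx≈y))

  ker-pow-finite : ∀ p → FiniteSet (ker p) → ∀ k → FiniteSet (ker (p ^ k))
  ker-pow-finite p fin zero    = ε ∷ [] , λ x x∙ε≈ε → Any.here (trans (sym (identityʳ x)) x∙ε≈ε)
  ker-pow-finite p fin (suc k) =
    finiteSet-⊆ (λ x → trans (sym (·-assoc p (p ^ k) x)))
                (preimage-finite (p ^ k) (ker-pow-finite p fin k) fin)

  module _ (L : Language) (M : FOL.Structure L Carrier _≈_) where
    open DefinableGroup A L using (IsDefinableSubgroup; DCC; DefinablyConnected)

    DCC⇒stabilises : DCC M → (H : ℕ → Carrier → Set) → (∀ k → IsDefinableSubgroup M (H k)) →
                     (∀ k → H (suc k) ⊆ H k) → Σ ℕ λ n → H n ⊆ H (suc n)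
    DCC⇒stabilises dcc H H-definable H-descending =
      dne λ never-stable → dcc (H , H-definable , λ k → H-descending k , strict never-stable k)
      where
        strict : ¬ (Σ ℕ λ n → H n ⊆ H (suc n)) → ∀ k → Σ Carrier λ x → H k x × ¬ H (suc k) x
        strict never-stable k =
          dne λ no-witness → never-stable (k , λ x Hkx → dne λ ∉Hsk → no-witness (x , Hkx , ∉Hsk))

    finiteIndex⇒full : DefinablyConnected M → ∀ {B} → IsDefinableSubgroup M B →
                             FiniteIndex B → ∀ x → B x
    finiteIndex⇒full connected B-definable B-finiteIndex x =
      dne λ ∉B → connected _ B-definable B-finiteIndex (x , ∉B)

module Renaming (L : Language) where
  open FOL L

  mutual
    renameᵗ : ∀ {n k} → (Fin n → Fin k) → Term n → Term k
    renameᵗ r (var i)     = var (r i)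
    renameᵗ r (func f ts) = func f (renameᵗˢ r ts)

    renameᵗˢ : ∀ {n k l} → (Fin n → Fin k) → Vec (Term n) l → Vec (Term k) l
    renameᵗˢ r []       = []
    renameᵗˢ r (t ∷ ts) = renameᵗ r t ∷ renameᵗˢ r ts

  rename : ∀ {n k} → (Fin n → Fin k) → Formula n → Formula k
  rename r ⊥f         = ⊥f
  rename r (s ≐ t)    = renameᵗ r s ≐ renameᵗ r t
  rename r (rel R ts) = rel R (renameᵗˢ r ts)
  rename r (φ ∧f ψ)   = rename r φ ∧f rename r ψ
  rename r (φ ∨f ψ)   = rename r φ ∨f rename r ψ
  rename r (φ ⇒f ψ)   = rename r φ ⇒f rename r ψ
  rename r (∀f φ)     = ∀f (rename (lift 1 r) φ)
  rename r (∃f φ)     = ∃f (rename (lift 1 r) φ)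

  module _ {C : Set} {_≈_ : C → C → Set} (M : Structure C _≈_) where
    open Structure M

    record Agree {n k} (r : Fin n → Fin k) (ρ : Vec C n) (ρ′ : Vec C k) : Set where
      constructor agree
      field lookup-agree : ∀ i → lookup ρ i ≡ lookup ρ′ (r i)
    open Agree

    agree-lift : ∀ {n k} {r : Fin n → Fin k} {ρ ρ′} → Agree r ρ ρ′ →
                 ∀ x → Agree (lift 1 r) (x ∷ ρ) (x ∷ ρ′)
    agree-lift ρ≡ρ′∘r x = agree λ where
      zero    → ≡.refl
      (suc i) → lookup-agree ρ≡ρ′∘r i

    mutual
      ⟦renameᵗ⟧ : ∀ {n k} {r : Fin n → Fin k} {ρ ρ′} → Agree r ρ ρ′ →
                  (t : Term n) → ⟦ renameᵗ r t ⟧t ρ′ ≡ ⟦ t ⟧t ρ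
      ⟦renameᵗ⟧ ρ≡ρ′∘r (var i)     = ≡.sym (lookup-agree ρ≡ρ′∘r i)
      ⟦renameᵗ⟧ ρ≡ρ′∘r (func f ts) = ≡.cong (funᴹ f) (⟦renameᵗˢ⟧ ρ≡ρ′∘r ts)

      ⟦renameᵗˢ⟧ : ∀ {n k l} {r : Fin n → Fin k} {ρ ρ′} → Agree r ρ ρ′ →
                   (ts : Vec (Term n) l) → ⟦ renameᵗˢ r ts ⟧ts ρ′ ≡ ⟦ ts ⟧ts ρ
      ⟦renameᵗˢ⟧ ρ≡ρ′∘r []       = ≡.refl
      ⟦renameᵗˢ⟧ ρ≡ρ′∘r (t ∷ ts) = ≡.cong₂ _∷_ (⟦renameᵗ⟧ ρ≡ρ′∘r t) (⟦renameᵗˢ⟧ ρ≡ρ′∘r ts)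

    Sat-rename : ∀ {n k} {r : Fin n → Fin k} {ρ ρ′} → Agree r ρ ρ′ →
                 (φ : Formula n) → Sat (rename r φ) ρ′ ⇔ Sat φ ρ
    Sat-rename ρ≡ρ′∘r ⊥f = ⇔-id _
    Sat-rename ρ≡ρ′∘r (s ≐ t)
      rewrite ⟦renameᵗ⟧ ρ≡ρ′∘r s | ⟦renameᵗ⟧ ρ≡ρ′∘r t = ⇔-id _
    Sat-rename ρ≡ρ′∘r (rel R ts) rewrite ⟦renameᵗˢ⟧ ρ≡ρ′∘r ts = ⇔-id _
    Sat-rename ρ≡ρ′∘r (φ ∧f ψ) = Sat-rename ρ≡ρ′∘r φ ×-⇔ Sat-rename ρ≡ρ′∘r ψ
    Sat-rename ρ≡ρ′∘r (φ ∨f ψ) = Sat-rename ρ≡ρ′∘r φ ⊎-⇔ Sat-rename ρ≡ρ′∘r ψ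
    Sat-rename ρ≡ρ′∘r (φ ⇒f ψ) = →-cong-⇔ (Sat-rename ρ≡ρ′∘r φ) (Sat-rename ρ≡ρ′∘r ψ)
    Sat-rename ρ≡ρ′∘r (∀f φ) =
      mk⇔ (λ f x → to (body x) (f x)) (λ f x → from (body x) (f x))
      where body = λ x → Sat-rename (agree-lift ρ≡ρ′∘r x) φ
    Sat-rename ρ≡ρ′∘r (∃f φ) =
      mk⇔ (map₂ (λ {x} → to (body x))) (map₂ (λ {x} → from (body x)))
      where body = λ x → Sat-rename (agree-lift ρ≡ρ′∘r x) φ

module DefinableMultiples (A : AbelianGroup 0ℓ 0ℓ) (L : Language) where
  open AbelianGroup A
  open DefinableGroup A L
  open Multiples A
  open Renaming L
  open import Algebra.Properties.AbelianGroup A using (identityˡ-unique)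

  module _ (M : Structure Carrier _≈_) (group-definable : GroupDefinable M) where
    open Structure M

    private
      m : ℕ
      m = proj₁ group-definable

      graph₀ : Formula (3 + m)
      graph₀ = proj₁ (proj₂ group-definable)

      params : Vec Carrier m
      params = proj₁ (proj₂ (proj₂ group-definable))

      graph₀-sat : ∀ x y z → Sat graph₀ (x ∷ y ∷ z ∷ params) ⇔ ((x ∙ y) ≈ z)
      graph₀-sat x y z = mk⇔ (proj₂ defines) (proj₁ defines)
        where defines = proj₂ (proj₂ (proj₂ group-definable)) (x ∷ y ∷ z ∷ [])

    relocate : ∀ {j} (a b c : Fin j) → Fin (3 + m) → Fin (j + m)
    relocate a b c zero                    = a ↑ˡ m
    relocate a b c (suc zero)              = b ↑ˡ m
    relocate a b c (suc (suc zero))        = c ↑ˡ m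
    relocate {j} a b c (suc (suc (suc i))) = j ↑ʳ i

    graph : ∀ {j} (a b c : Fin j) → Formula (j + m)
    graph a b c = rename (relocate a b c) graph₀

    graph-sat : ∀ {j} (xs : Vec Carrier j) a b c →
                Sat (graph a b c) (xs ++ params) ⇔ ((lookup xs a ∙ lookup xs b) ≈ lookup xs c)
    graph-sat xs a b c = graph₀-sat _ _ _ ⇔-∘ Sat-rename M (agree relocated) graph₀
      where
        relocated : ∀ i → lookup (lookup xs a ∷ lookup xs b ∷ lookup xs c ∷ params) i
                          ≡ lookup (xs ++ params) (relocate a b c i)
        relocated zero                = ≡.sym (lookup-++ˡ xs params a)
        relocated (suc zero)          = ≡.sym (lookup-++ˡ xs params b)
        relocated (suc (suc zero))    = ≡.sym (lookup-++ˡ xs params c)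
        relocated (suc (suc (suc i))) = ≡.sym (lookup-++ʳ xs params i)

    -- (1 + n) · y is y ∙ w for a fresh variable w (de Bruijn index 0) subject to w = n · y
    multiple : ∀ {j} → ℕ → Fin j → Fin j → Formula (j + m)
    multiple zero    y z = graph z z z
    multiple (suc n) y z = ∃f (multiple n (suc y) zero ∧f graph (suc y) zero (suc z))

    multiple-sat : ∀ n {j} (xs : Vec Carrier j) y z →
                   Sat (multiple n y z) (xs ++ params) ⇔ (lookup xs z ≈ (n · lookup xs y))
    multiple-sat zero xs y z = idempotent⇔ε ⇔-∘ graph-sat xs z z z
      where
        idempotent⇔ε : ∀ {x} → (x ∙ x) ≈ x ⇔ x ≈ ε
        idempotent⇔ε {x} = mk⇔ (identityˡ-unique x x)
          (λ x≈ε → trans (∙-cong x≈ε x≈ε) (trans (identityˡ ε) (sym x≈ε)))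
    multiple-sat (suc n) xs y z = mk⇔
      (λ { (w , w≈ny , y∙w≈z) → trans (sym (to (graph-sat (w ∷ xs) (suc y) zero (suc z)) y∙w≈z))
                                      (∙-congˡ (to (multiple-sat n (w ∷ xs) (suc y) zero) w≈ny)) })
      (λ z≈y∙ny → n · lookup xs y ,
                  from (multiple-sat n (_ ∷ xs) (suc y) zero) refl ,
                  from (graph-sat (_ ∷ xs) (suc y) zero (suc z)) (sym z≈y∙ny))

    img-definableSubgroup : ∀ n → IsDefinableSubgroup M (img n)
    img-definableSubgroup n =
      img-isSubgroup n , m , ∃f (multiple n zero (suc zero)) , params , λ where
        (x ∷ []) → map₂ (λ {y} → from (multiple-sat n (y ∷ x ∷ []) zero (suc zero))) ,
                   map₂ (λ {y} → to (multiple-sat n (y ∷ x ∷ []) zero (suc zero)))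

module DefinablyConnectedDCC
  (em : ExcludedMiddle 0ℓ) (A : AbelianGroup 0ℓ 0ℓ) (L : Language)
  where
  open AbelianGroup A
  open DefinableGroup A L
  open Multiples A
  open Classical em A
  open DefinableMultiples A L

  module _ (M : Structure Carrier _≈_) (group-definable : GroupDefinable M)
           (connected : DefinablyConnected M) (dcc : DCC M) where

    stable⇒divisibleBy : ∀ p → FiniteSet (ker p) → ∀ n → img (p ^ n) ⊆ img (p ^ suc n) →
                         DivisibleBy p
    stable⇒divisibleBy p ker-finite n stable a =
      map₂ proj₂ (B⊆pB a (finiteIndex⇒full L M connected B-definable index a))
      where
        B-definable : IsDefinableSubgroup M (img (p ^ n))
        B-definable = img-definableSubgroup M group-definable (p ^ n)

        B⊆pB : img (p ^ n) ⊆ (p ·ˢ img (p ^ n))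
        B⊆pB = img-stable⇒⊆·ˢ {p} {n} stable

        index : FiniteIndex (img (p ^ n))
        index = finiteKernel⇒finiteIndex {p ^ n} (ker-pow-finite p ker-finite n)
                  (img-isSubgroup (p ^ n)) (⊆-·ˢ-pow {p} B⊆pB n)

    finiteKernel⇒divisibleBy : ∀ p → FiniteSet (ker p) → DivisibleBy p
    finiteKernel⇒divisibleBy p ker-finite =
      uncurry (stable⇒divisibleBy p ker-finite)
        (DCC⇒stabilises L M dcc (λ k → img (p ^ k))
          (λ k → img-definableSubgroup M group-definable (p ^ k)) (λ k → img-antitone (n∣m*n p)))

corollary4p4 :
    ExcludedMiddle 0ℓ →
    (A : AbelianGroup 0ℓ 0ℓ) (L : Language) →
    let open AbelianGroup A
        open DefinableGroup A L
    in (M : Structure Carrier _≈_) →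
       GroupDefinable M →
       DefinablyConnected M →
       DCC M →
       ((p : ℕ) → Prime p → (H : Carrier → Set) →
          IsElementaryAbelianPSubgroup p H → ¬ Infinite H) →
       Divisible
corollary4p4 em A L M group-definable connected dcc elementary-finite =
  divisibleByPrimes⇒divisible λ p p-prime →
    finiteKernel⇒divisibleBy M group-definable connected dcc p
      (dne (elementary-finite p p-prime (ker p) (ker-isSubgroup p , λ _ x∈ker → x∈ker)))
  where
    open Multiples A
    open Classical em A using (dne)
    open DefinablyConnectedDCC em A L
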